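{- Let $n\ge 3$ and let $C_n$ be the cycle graph with vertices $v_1,\ldots,v_n$ in cyclic order. Let $S\subseteq V(C_n)$ be $C_n$-admissible, i.e. $P(S;C_n)\neq\emptyset$. For $v_i\in S$ let $\widehat{S_i}=S\setminus\{v_i\}$, regarded as a set of positions in the path $C_n\setminus\{v_i\}$ whose vertices are listed in order $v_{i+1},\ldots,v_n,v_1,\ldots,v_{i-1}$ (positions $1,\ldots,n-1$). Then \[ |P(S;C_n)| = 2^{\,n-|S|-1}\sum_{v_i\in S} p_{\widehat{S_i}}(n-1), \] where $p_{T}$ denotes the peak polynomial of the set $T$ of positive integers.
   Context: For a finite simple graph $G$ with $N$ vertices, a labeling is a bijection $\ell:V(G)\to\{1,\ldots,N\}$; it has a peak at $v$ if $\deg_G(v)\ge 2$ and $\ell(v)>\ell(w)$ for all neighbors $w$ of $v$. $P(S;G)$ is the set of labelings whose set of peaks is exactly $S$. For permutations $\pi=\pi_1\cdots\pi_m\in\mathfrak S_m$, $\pi$ has a peak at index $i$ if $1<i<m$ and $\pi_{i-1}<\pi_i>\pi_{i+1}$, and $P(T;m)$ is the set of $\pi\in\mathfrak S_m$ with peak set exactly $T$ (this coincides with peak sets of labelings of the path graph on $m$ vertices, labeling the $i$-th vertex by $\pi_i$). By a theorem of Billey, Burdzy and Sagan, for each finite set $T$ of positive integers there is a polynomial $p_T(x)$ (the peak polynomial, of degree $\max(T)-1$) such that $|P(T;m)|=2^{m-|T|-1}p_T(m)$ for all $m\ge \max(T)$ (with $p_\emptyset=1$). -}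

module Defs where

open import Data.Nat as ℕ using (ℕ; zero; suc; _+_; _∸_; _^_; _≤_; _≤?_)
open import Data.Nat.DivMod using (_%_)
open import Data.Fin as Fin using (Fin; toℕ; _<?_)
open import Data.Fin.Properties using (all?; _≟_)
open import Data.Fin.Subset using (Subset; _∈_)
open import Data.Fin.Subset.Properties using (_∈?_)
open import Data.Vec as Vec using (Vec; []; _∷_; lookup)
open import Data.List as List using (List; []; _∷_; map; concatMap; filter; length; allFin; foldr)
open import Data.List.Relation.Unary.All using (All)
open import Data.List.Relation.Unary.AllPairs using (AllPairs)
open import Data.List.Membership.Propositional using () renaming (_∈_ to _∈ₗ_)
open import Data.List.Membership.DecPropositional ℕ._≟_ using () renaming (_∈?_ to _∈ℕ?_)
open import Data.Integer as ℤ using (ℤ)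
open import Data.Rational as ℚ using (ℚ)
open import Data.Product using (_×_; Σ)
open import Data.Sum using (_⊎_)
open import Function using (_∘_; _⇔_)
open import Relation.Binary.PropositionalEquality using (_≡_)
open import Relation.Binary using (Decidable)
open import Relation.Nullary using (Dec)
open import Relation.Nullary.Decidable using (_×-dec_; _→-dec_; map′) renaming (_⊎-dec_ to _⊎?_)
open import Function.Bundles using (mk⇔; Equivalence)
open import Data.Product using (_,_)

_⇔-dec_ : ∀ {A B : Set} → Dec A → Dec B → Dec (A ⇔ B)
a ⇔-dec b = map′ (λ fg → mk⇔ (proj₁ fg) (proj₂ fg))
                 (λ e → Equivalence.to e , Equivalence.from e)
                 ((a →-dec b) ×-dec (b →-dec a))
  where open import Data.Product using (proj₁; proj₂)

record Graph (N : ℕ) : Set₁ where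
  field
    Adj  : Fin N → Fin N → Set
    adj? : Decidable Adj

open Graph public

degree : ∀ {N} → Graph N → Fin N → ℕ
degree {N} G v = length (filter (adj? G v) (allFin N))

-- Labelings: a bijection V(G) = Fin N → {1,…,N}.  We encode the label
-- k+1 by k : Fin N (this preserves the order), so a labeling is an
-- injective vector σ : Vec (Fin N) N (injective ⇒ bijective here).

allVecs : (m k : ℕ) → List (Vec (Fin k) m)
allVecs zero    k = [] ∷ []
allVecs (suc m) k = concatMap (λ x → map (x ∷_) (allVecs m k)) (allFin k)

Injective : ∀ {N} → Vec (Fin N) N → Set
Injective {N} σ = ∀ (i j : Fin N) → lookup σ i ≡ lookup σ j → i ≡ j

injective? : ∀ {N} (σ : Vec (Fin N) N) → Dec (Injective σ)
injective? σ = all? (λ i → all? (λ j → (lookup σ i ≟ lookup σ j) →-dec (i ≟ j)))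

labelings : (N : ℕ) → List (Vec (Fin N) N)
labelings N = filter injective? (allVecs N N)

IsPeak : ∀ {N} (G : Graph N) → Vec (Fin N) N → Fin N → Set
IsPeak {N} G σ v = (2 ≤ degree G v) × (∀ (w : Fin N) → Adj G v w → lookup σ w Fin.< lookup σ v)

isPeak? : ∀ {N} (G : Graph N) (σ : Vec (Fin N) N) (v : Fin N) → Dec (IsPeak G σ v)
isPeak? G σ v = (2 ≤? degree G v) ×-dec all? (λ w → adj? G v w →-dec (lookup σ w <? lookup σ v))

-- Path graph on m vertices: vertex j : Fin m is the (j+1)-st vertex,
-- i.e. position j+1.  Edges {j, j+1}.

PathAdj : ∀ {m} → Fin m → Fin m → Set
PathAdj v w = (suc (toℕ v) ≡ toℕ w) ⊎ (suc (toℕ w) ≡ toℕ v)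

Path : (m : ℕ) → Graph m
Path m = record
  { Adj  = PathAdj
  ; adj? = λ v w → (suc (toℕ v) ℕ.≟ toℕ w) ⊎? (suc (toℕ w) ℕ.≟ toℕ v) }

-- A finite set T of positive integers, given as a strictly increasing
-- list of positive naturals (canonical representation, |T| = length T).
IsFinSetOfPos : List ℕ → Set
IsFinSetOfPos T = AllPairs ℕ._<_ T × All (1 ≤_) T

PeaksPathExactly : ∀ {m} → List ℕ → Vec (Fin m) m → Set
PeaksPathExactly {m} T σ = ∀ (j : Fin m) → IsPeak (Path m) σ j ⇔ (suc (toℕ j) ∈ₗ T)

peaksPathExactly? : ∀ {m} (T : List ℕ) (σ : Vec (Fin m) m) → Dec (PeaksPathExactly T σ)
peaksPathExactly? {m} T σ = all? (λ j → isPeak? (Path m) σ j ⇔-dec (suc (toℕ j) ∈ℕ? T))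

countPath : List ℕ → ℕ → ℕ
countPath T m = length (filter (peaksPathExactly? T) (labelings m))

-- Cycle graph C_n: vertex i : Fin n is v_{i+1}; edges {v_i, v_{i+1}}
-- with indices mod n.

CycAdj : ∀ {n} → Fin n → Fin n → Set
CycAdj {suc k} v w = (toℕ w ≡ (toℕ v + 1) % suc k) ⊎ (toℕ v ≡ (toℕ w + 1) % suc k)

cycAdj? : ∀ {n} → Decidable (CycAdj {n})
cycAdj? {suc k} v w = (toℕ w ℕ.≟ (toℕ v + 1) % suc k) ⊎? (toℕ v ℕ.≟ (toℕ w + 1) % suc k)

Cycle : (n : ℕ) → Graph n
Cycle n = record { Adj = CycAdj ; adj? = cycAdj? }

PeaksCycleExactly : ∀ {n} → Subset n → Vec (Fin n) n → Set
PeaksCycleExactly {n} S σ = ∀ (v : Fin n) → IsPeak (Cycle n) σ v ⇔ (v ∈ S)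

peaksCycleExactly? : ∀ {n} (S : Subset n) (σ : Vec (Fin n) n) → Dec (PeaksCycleExactly S σ)
peaksCycleExactly? {n} S σ = all? (λ v → isPeak? (Cycle n) σ v ⇔-dec (v ∈? S))

countCycle : (n : ℕ) → Subset n → ℕ
countCycle n S = length (filter (peaksCycleExactly? S) (labelings n))

Admissible : (n : ℕ) → Subset n → Set
Admissible n S = 1 ≤ countCycle n S

-- Ŝ_i: for vertex i (= v_{i+1}), the set S \ {v_{i+1}} as positions in the
-- path C_n ∖ {v_{i+1}} listed as v_{i+2}, …, v_n, v_1, …, v_i.  Position
-- p ∈ {1,…,n-1} holds the vertex with index (i + p) mod n (0-based).
-- Listed in increasing order, so it is a finite set of positive integers.
hatS : ∀ {n} → Subset n → Fin n → List ℕ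
hatS {suc k} S i =
  map (λ (j : Fin k) → suc (toℕ j))
      (filter (λ (j : Fin k) → Fin.fromℕ< (Data.Nat.DivMod.m%n<n (toℕ i + suc (toℕ j)) (suc k)) ∈? S)
              (allFin k))
  where import Data.Nat.DivMod

-- A function p : (finite sets T) → ℕ → ℤ whose
-- restriction p T is a polynomial (with rational coefficients) and which
-- satisfies the Billey–Burdzy–Sagan identity
--   |P(T;m)| = 2^(m - |T| - 1) · p_T(m)   for all m ≥ max T (m ≥ 1).
-- By BBS such a p exists and its values p T m are uniquely determined.

evalPoly : List ℚ → ℚ → ℚ
evalPoly cs x = foldr (λ c acc → c ℚ.+ x ℚ.* acc) ℚ.0ℚ cs

IsPolynomial : (ℕ → ℤ) → Set
IsPolynomial f = Σ (List ℚ) (λ cs → ∀ (m : ℕ) → (f m ℚ./ 1) ≡ evalPoly cs (ℤ.+ m ℚ./ 1))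

IsPeakPolynomials : (List ℕ → ℕ → ℤ) → Set
IsPeakPolynomials p =
  ∀ (T : List ℕ) → IsFinSetOfPos T →
    IsPolynomial (p T) ×
    (∀ (m : ℕ) → 1 ≤ m → All (_≤ m) T →
       ℤ.+ countPath T m ≡ ℤ.+ (2 ^ (m ∸ length T ∸ 1)) ℤ.* p T m)

sumℤ : List ℤ → ℤ
sumℤ = foldr ℤ._+_ (ℤ.+ 0)

module Submission where

-- Write n = N and k = N - 1.  In a labeling σ of C_N the vertex carrying the
-- largest label is always a peak (every vertex of a cycle has degree 2), so
-- P(S;C_N) splits according to the position i of the largest label, and only
-- positions i ∈ S contribute.  Deleting vᵢ leaves the path
-- v_{i+1}, …, v_N, v_1, …, v_{i-1}; reading σ along it gives a labeling τ of
-- the path on k vertices, and σ ↦ τ is a bijection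
--   { σ ∈ P(S;C_N) : σ(vᵢ) = N }  ≅  P(Ŝᵢ; k)
-- because the two neighbours of vᵢ become the path's endpoints, which are
-- peaks in neither graph (degree 1 in the path, adjacent to the maximum in
-- the cycle), while adjacency and peaks of all other vertices are preserved.
-- Hence
--   |P(S;C_N)| = Σ_{i ∈ S} |P(Ŝᵢ;k)|,
-- and the Billey–Burdzy–Sagan identity |P(Ŝᵢ;k)| = 2^(k-|Ŝᵢ|-1) p_{Ŝᵢ}(k)
-- together with |Ŝᵢ| = |S| - 1 gives the theorem.

open import Defs
open import Data.Bool using (true; false; if_then_else_)
open import Data.Fin as Fin using (Fin; toℕ; fromℕ; fromℕ<; inject₁)
import Data.Fin.Properties as Finₚ
open import Data.Fin.Subset using (Subset; _∈_; ∣_∣; inside; outside)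
open import Data.Fin.Subset.Properties using (_∈?_)
open import Data.Integer as ℤ using (ℤ; +_; _*_)
import Data.Integer.Properties as ℤₚ
open import Data.List as List using (List; []; _∷_; length; filter; map; allFin; concat; cartesianProductWith; _++_)
open import Data.List.Membership.Propositional using (_∉_) renaming (_∈_ to _∈ₗ_)
open import Data.List.Membership.Propositional.Properties using (∈-filter⁺; ∈-filter⁻; ∈-allFin; ∈-map⁺; ∈-map⁻; ∈-cartesianProductWith⁺)
open import Data.List.Properties using (filter-accept; filter-reject; filter-none; length-map; length-removeAt′)
open import Data.List.Relation.Unary.All as All using (All; []; _∷_)
import Data.List.Relation.Unary.All.Properties as Allₚ
open import Data.List.Relation.Unary.AllPairs using ([]; _∷_)
import Data.List.Relation.Unary.AllPairs.Properties as AllPairsₚ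
open import Data.List.Relation.Unary.Any using (here; there; index; _─_)
open import Data.List.Relation.Unary.Unique.Propositional using (Unique)
import Data.List.Relation.Unary.Unique.Propositional.Properties as Uniqueₚ
open import Data.Nat as ℕ using (ℕ; zero; suc; _+_; _∸_; _^_; _<_; _≤_; z≤n; s≤s)
open import Data.Nat.DivMod using (_%_; _/_; %-distribˡ-+; m%n%n≡m%n; [m+kn]%n≡m%n; m<n⇒m%n≡m; m%n<n; m%n≤n; m≡m%n+[m/n]*n; [m+n]%n≡m%n; _mod_)
open import Data.Nat.ListAction using (sum)
import Data.Nat.Properties as ℕₚ
open import Data.Nat.Solver using (module +-*-Solver)
open import Data.Product using (Σ; _×_; _,_; proj₁; proj₂)
open import Data.Sum using (_⊎_; inj₁; inj₂)
open import Data.Vec as Vec using (Vec; lookup; tabulate)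
import Data.Vec.Properties as Vecₚ
import Function.Properties.Equivalence as ⇔
open import Function using (_∘_; id; _⇔_; mk⇔; Equivalence)
open import Relation.Binary.Definitions using (DecidableEquality)
open import Relation.Binary.PropositionalEquality using (_≡_; _≢_; refl; sym; trans; cong; cong₂; subst; subst₂; module ≡-Reasoning)
open import Relation.Nullary using (¬_; Dec; yes; no; does; contradiction)
open import Relation.Nullary.Decidable using (_×-dec_; _⊎-dec_; ¬?)
open import Relation.Unary using (Decidable)

open ≡-Reasoning

private
  variable
    A B C : Set

count : {P : A → Set} → Decidable P → List A → ℕ
count P? xs = length (filter P? xs)

𝟙 : {P : A → Set} → Decidable P → A → ℕ
𝟙 P? a = if does (P? a) then 1 else 0

𝟙-yes : {P : A → Set} (P? : Decidable P) {a : A} → P a → 𝟙 P? a ≡ 1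
𝟙-yes P? {a} pa with P? a
... | yes _  = refl
... | no ¬pa = contradiction pa ¬pa

𝟙-no : {P : A → Set} (P? : Decidable P) {a : A} → ¬ P a → 𝟙 P? a ≡ 0
𝟙-no P? {a} ¬pa with P? a
... | yes pa = contradiction pa ¬pa
... | no _   = refl

count-∷ : {P : A → Set} (P? : Decidable P) (x : A) (xs : List A) →
          count P? (x ∷ xs) ≡ 𝟙 P? x + count P? xs
count-∷ P? x xs with does (P? x)
... | true  = refl
... | false = refl

sum-map-+ : (f g : A → ℕ) (xs : List A) →
            sum (map (λ a → f a + g a) xs) ≡ sum (map f xs) + sum (map g xs)
sum-map-+ f g []       = refl
sum-map-+ f g (x ∷ xs) = begin
  f x + g x + sum (map (λ a → f a + g a) xs)    ≡⟨ cong (_+_ (f x + g x)) (sum-map-+ f g xs) ⟩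
  f x + g x + (sum (map f xs) + sum (map g xs)) ≡⟨ interchange (f x) (g x) _ _ ⟩
  f x + sum (map f xs) + (g x + sum (map g xs))  ∎
  where
  open +-*-Solver
  interchange : ∀ a b c d → a + b + (c + d) ≡ a + c + (b + d)
  interchange = solve 4 (λ a b c d → (a :+ b) :+ (c :+ d) := (a :+ c) :+ (b :+ d)) refl

sum-map-cong : {f g : A → ℕ} (xs : List A) → (∀ {x} → x ∈ₗ xs → f x ≡ g x) →
               sum (map f xs) ≡ sum (map g xs)
sum-map-cong []       f≡g = refl
sum-map-cong (x ∷ xs) f≡g = cong₂ _+_ (f≡g (here refl)) (sum-map-cong xs (f≡g ∘ there))

sum-map-filter : {S : A → Set} (S? : Decidable S) (f : A → ℕ) (xs : List A) →
                 (∀ a → ¬ S a → f a ≡ 0) → sum (map f xs) ≡ sum (map f (filter S? xs))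
sum-map-filter S? f []       f₀ = refl
sum-map-filter S? f (x ∷ xs) f₀ with S? x
... | yes _  = cong (_+_ (f x)) (sum-map-filter S? f xs f₀)
... | no ¬sx = trans (cong (_+ sum (map f xs)) (f₀ x ¬sx)) (sum-map-filter S? f xs f₀)

count-filter : {P Q : A → Set} (P? : Decidable P) (Q? : Decidable Q) (xs : List A) →
               count P? (filter Q? xs) ≡ count (λ x → Q? x ×-dec P? x) xs
count-filter P? Q? []       = refl
count-filter P? Q? (x ∷ xs) with Q? x | P? x
... | yes _ | yes p rewrite filter-accept P? {x} {filter Q? xs} p = cong suc (count-filter P? Q? xs)
... | yes _ | no ¬p rewrite filter-reject P? {x} {filter Q? xs} ¬p = count-filter P? Q? xs
... | no _  | _     = count-filter P? Q? xs

sum-𝟙-none : {R : A → Set} (R? : Decidable R) (xs : List A) →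
             All (λ a → ¬ R a) xs → sum (map (𝟙 R?) xs) ≡ 0
sum-𝟙-none R? []       []          = refl
sum-𝟙-none R? (x ∷ xs) (¬rx ∷ ¬rs) = cong₂ _+_ (𝟙-no R? ¬rx) (sum-𝟙-none R? xs ¬rs)

sum-𝟙-unique : {R : A → Set} (R? : Decidable R) (xs : List A) {c : A} →
               Unique xs → c ∈ₗ xs → R c → (∀ {a} → R a → a ≡ c) → sum (map (𝟙 R?) xs) ≡ 1
sum-𝟙-unique R? (x ∷ xs) (x∉ ∷ _) (here refl) rc only =
  cong₂ _+_ (𝟙-yes R? rc) (sum-𝟙-none R? xs (All.map (λ x≢a ra → x≢a (sym (only ra))) x∉))
sum-𝟙-unique R? (x ∷ xs) (x∉ ∷ u) (there c∈) rc only =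
  cong₂ _+_ (𝟙-no R? (λ rx → All.lookup x∉ c∈ (only rx))) (sum-𝟙-unique R? xs u c∈ rc only)

count-partition : {P : A → Set} {Q : C → A → Set}
  (P? : Decidable P) (Q? : ∀ c → Decidable (Q c)) (cs : List C) → Unique cs → (∀ c → c ∈ₗ cs) →
  (∀ {a} → P a → Σ C λ c → Q c a) → (∀ {a c d} → P a → Q c a → Q d a → c ≡ d) →
  (xs : List A) → count P? xs ≡ sum (map (λ c → count (λ a → P? a ×-dec Q? c a) xs) cs)
count-partition {C = C} {P = P} {Q = Q} P? Q? cs ucs all-cs class class-unique = go
  where
  PQ? : ∀ c → Decidable (λ a → P a × Q c a)
  PQ? c a = P? a ×-dec Q? c a

  𝟙-split : ∀ x → 𝟙 P? x ≡ sum (map (λ c → 𝟙 (PQ? c) x) cs)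
  𝟙-split x = by-cases (P? x)
    where
    by-cases : Dec (P x) → 𝟙 P? x ≡ sum (map (λ c → 𝟙 (PQ? c) x) cs)
    by-cases (yes px) = trans (𝟙-yes P? px) (sym (sum-𝟙-unique (λ c → PQ? c x) cs ucs
      (all-cs (proj₁ (class px))) (px , proj₂ (class px))
      (λ pq → class-unique px (proj₂ pq) (proj₂ (class px)))))
    by-cases (no ¬px) = trans (𝟙-no P? ¬px)
      (sym (sum-𝟙-none (λ c → PQ? c x) cs (All.universal (λ _ pq → ¬px (proj₁ pq)) cs)))

  sum-zero : (ds : List C) → sum (map (λ _ → 0) ds) ≡ 0
  sum-zero []       = refl
  sum-zero (_ ∷ ds) = sum-zero ds

  go : ∀ xs → count P? xs ≡ sum (map (λ c → count (PQ? c) xs) cs)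
  go []       = sym (sum-zero cs)
  go (x ∷ xs) = begin
    count P? (x ∷ xs)                                    ≡⟨ count-∷ P? x xs ⟩
    𝟙 P? x + count P? xs                                 ≡⟨ cong₂ _+_ (𝟙-split x) (go xs) ⟩
    sum (map (λ c → 𝟙 (PQ? c) x) cs)
      + sum (map (λ c → count (PQ? c) xs) cs)            ≡⟨ sum-map-+ _ _ cs ⟨
    sum (map (λ c → 𝟙 (PQ? c) x + count (PQ? c) xs) cs)  ≡⟨ sum-map-cong cs (λ {c} _ → count-∷ (PQ? c) x xs) ⟨
    sum (map (λ c → count (PQ? c) (x ∷ xs)) cs)          ∎

module _ {P : A → Set} (P? : Decidable P) (_≟_ : DecidableEquality A) (c : A) where

  P-but? : Decidable (λ x → P x × x ≢ c)
  P-but? x = P? x ×-dec ¬? (x ≟ c)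

  private
    𝟙-agree : ∀ {x} → x ≢ c → 𝟙 P? x ≡ 𝟙 P-but? x
    𝟙-agree {x} x≢c = by-cases (P? x)
      where
      by-cases : Dec (P x) → 𝟙 P? x ≡ 𝟙 P-but? x
      by-cases (yes px) = trans (𝟙-yes P? px) (sym (𝟙-yes P-but? (px , x≢c)))
      by-cases (no ¬px) = trans (𝟙-no P? ¬px) (sym (𝟙-no P-but? (¬px ∘ proj₁)))

    count-without : ∀ xs → c ∉ xs → count P? xs ≡ count P-but? xs
    count-without []       _  = refl
    count-without (x ∷ xs) c∉ = begin
      count P? (x ∷ xs)            ≡⟨ count-∷ P? x xs ⟩
      𝟙 P? x + count P? xs         ≡⟨ cong₂ _+_ (𝟙-agree (λ x≡c → c∉ (here (sym x≡c))))
                                                (count-without xs (c∉ ∘ there)) ⟩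
      𝟙 P-but? x + count P-but? xs ≡⟨ count-∷ P-but? x xs ⟨
      count P-but? (x ∷ xs)        ∎

  count-remove : ∀ xs → Unique xs → c ∈ₗ xs → P c → count P? xs ≡ suc (count P-but? xs)
  count-remove (x ∷ xs) (x∉ ∷ _) (here refl) pc = begin
    count P? (x ∷ xs)             ≡⟨ count-∷ P? x xs ⟩
    𝟙 P? x + count P? xs          ≡⟨ cong₂ _+_ (𝟙-yes P? pc) (count-without xs (λ c∈ → All.lookup x∉ c∈ refl)) ⟩
    1 + count P-but? xs           ≡⟨ cong (λ z → suc (z + count P-but? xs)) (𝟙-no P-but? (λ p → proj₂ p refl)) ⟨
    suc (𝟙 P-but? x + count P-but? xs) ≡⟨ cong suc (count-∷ P-but? x xs) ⟨
    suc (count P-but? (x ∷ xs))   ∎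
  count-remove (x ∷ xs) (x∉ ∷ u) (there c∈) pc = begin
    count P? (x ∷ xs)                  ≡⟨ count-∷ P? x xs ⟩
    𝟙 P? x + count P? xs               ≡⟨ cong₂ _+_ (𝟙-agree (All.lookup x∉ c∈)) (count-remove xs u c∈ pc) ⟩
    𝟙 P-but? x + suc (count P-but? xs) ≡⟨ ℕₚ.+-suc (𝟙 P-but? x) _ ⟩
    suc (𝟙 P-but? x + count P-but? xs) ≡⟨ cong suc (count-∷ P-but? x xs) ⟨
    suc (count P-but? (x ∷ xs))        ∎

length-≤-injection : (xs : List A) (ys : List B) (f : A → B) → Unique xs →
  (∀ {a} → a ∈ₗ xs → f a ∈ₗ ys) → (∀ {a a'} → a ∈ₗ xs → a' ∈ₗ xs → f a ≡ f a' → a ≡ a') →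
  length xs ≤ length ys
length-≤-injection []       ys f _          into inj = z≤n
length-≤-injection (a ∷ xs) ys f (a∉ ∷ uxs) into inj =
  subst (suc (length xs) ≤_) (sym (length-removeAt′ ys (index fa∈)))
    (s≤s (length-≤-injection xs (ys ─ fa∈) f uxs into′ (λ p q → inj (there p) (there q))))
  where
  fa∈ = into (here refl)

  ∈-─ : {y z : B} (zs : List B) (y∈ : y ∈ₗ zs) → z ∈ₗ zs → z ≢ y → z ∈ₗ (zs ─ y∈)
  ∈-─ (_ ∷ _)  (here refl) (here refl) z≢y = contradiction refl z≢y
  ∈-─ (_ ∷ _)  (here refl) (there z∈)  _   = z∈
  ∈-─ (_ ∷ _)  (there _)   (here refl) _   = here refl
  ∈-─ (_ ∷ zs) (there y∈)  (there z∈)  z≢y = there (∈-─ zs y∈ z∈ z≢y)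

  into′ : ∀ {a'} → a' ∈ₗ xs → f a' ∈ₗ (ys ─ fa∈)
  into′ a'∈ = ∈-─ ys fa∈ (into (there a'∈))
                (λ e → All.lookup a∉ a'∈ (inj (here refl) (there a'∈) (sym e)))

count-bijection : {P : A → Set} {Q : B → Set} (P? : Decidable P) (Q? : Decidable Q)
  (xs : List A) (ys : List B) → Unique xs → Unique ys →
  (∀ {a} → P a → a ∈ₗ xs) → (∀ {b} → Q b → b ∈ₗ ys) →
  (f : A → B) (g : B → A) → (∀ {a} → P a → Q (f a)) → (∀ {b} → Q b → P (g b)) →
  (∀ {a} → P a → g (f a) ≡ a) → (∀ {b} → Q b → f (g b) ≡ b) →
  count P? xs ≡ count Q? ys
count-bijection P? Q? xs ys uxs uys P⊆xs Q⊆ys f g PQ QP gf fg = ℕₚ.≤-antisym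
  (length-≤-injection (filter P? xs) (filter Q? ys) f (Uniqueₚ.filter⁺ P? uxs)
     (λ a∈ → let pa = P-of a∈ in ∈-filter⁺ Q? (Q⊆ys (PQ pa)) (PQ pa))
     (λ a∈ a'∈ e → trans (sym (gf (P-of a∈))) (trans (cong g e) (gf (P-of a'∈)))))
  (length-≤-injection (filter Q? ys) (filter P? xs) g (Uniqueₚ.filter⁺ Q? uys)
     (λ b∈ → let qb = Q-of b∈ in ∈-filter⁺ P? (P⊆xs (QP qb)) (QP qb))
     (λ b∈ b'∈ e → trans (sym (fg (Q-of b∈))) (trans (cong f e) (fg (Q-of b'∈)))))
  where
  P-of = λ {a} (a∈ : a ∈ₗ filter P? xs) → proj₂ (∈-filter⁻ P? {xs = xs} a∈)
  Q-of = λ {b} (b∈ : b ∈ₗ filter Q? ys) → proj₂ (∈-filter⁻ Q? {xs = ys} b∈)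

private
  reflects-tail : ∀ {n b} {S : Subset n} {g : Fin (suc n) → A} {P : A → Set} →
                  (∀ j → P (g j) ⇔ j ∈ (b Vec.∷ S)) → ∀ j → P (g (Fin.suc j)) ⇔ j ∈ S
  reflects-tail r j = ⇔.trans (r (Fin.suc j)) (mk⇔ (λ { (Vec.there j∈) → j∈ }) Vec.there)

∣∣-count : ∀ {n} (S : Subset n) (g : Fin n → A) {P : A → Set} (P? : Decidable P) →
           (∀ j → P (g j) ⇔ j ∈ S) → ∣ S ∣ ≡ count P? (List.tabulate g)
∣∣-count Vec.[]            g P? r = refl
∣∣-count (inside Vec.∷ S)  g {P} P? r = sym (trans (count-∷ P? (g Fin.zero) _)
  (cong₂ _+_ (𝟙-yes P? (Equivalence.from (r Fin.zero) Vec.here))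
             (sym (∣∣-count S (g ∘ Fin.suc) P? (reflects-tail {g = g} {P = P} r)))))
∣∣-count (outside Vec.∷ S) g {P} P? r = sym (trans (count-∷ P? (g Fin.zero) _)
  (cong₂ _+_ (𝟙-no P? (zero∉ ∘ Equivalence.to (r Fin.zero)))
             (sym (∣∣-count S (g ∘ Fin.suc) P? (reflects-tail {g = g} {P = P} r)))))
  where
  zero∉ : ¬ (Fin.zero ∈ (outside Vec.∷ S))
  zero∉ ()

private
  allVecs-∷ : ∀ {m k} → allVecs (suc m) k ≡ cartesianProductWith Vec._∷_ (allFin k) (allVecs m k)
  allVecs-∷ {m} {k} = go (allFin k)
    where
    go : (hs : List (Fin k)) →
         concat (map (λ h → map (h Vec.∷_) (allVecs m k)) hs) ≡ cartesianProductWith Vec._∷_ hs (allVecs m k)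
    go []       = refl
    go (h ∷ hs) = cong (map (h Vec.∷_) (allVecs m k) ++_) (go hs)

allVecs-unique : ∀ m k → Unique (allVecs m k)
allVecs-unique zero    k = [] ∷ []
allVecs-unique (suc m) k = subst Unique (sym allVecs-∷)
  (Uniqueₚ.cartesianProductWith⁺ Vec._∷_ (λ e → Vecₚ.∷-injectiveˡ e , Vecₚ.∷-injectiveʳ e)
    (Uniqueₚ.allFin⁺ k) (allVecs-unique m k))

allVecs-complete : ∀ {m k} (v : Vec (Fin k) m) → v ∈ₗ allVecs m k
allVecs-complete Vec.[]       = here refl
allVecs-complete (x Vec.∷ v) = subst (x Vec.∷ v ∈ₗ_) (sym allVecs-∷)
  (∈-cartesianProductWith⁺ Vec._∷_ (∈-allFin x) (allVecs-complete v))

vec-ext : ∀ {n} (a b : Vec A n) → (∀ v → lookup a v ≡ lookup b v) → a ≡ b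
vec-ext a b same = trans (sym (Vecₚ.tabulate∘lookup a)) (trans (Vecₚ.tabulate-cong same) (Vecₚ.tabulate∘lookup b))

module Modular (k : ℕ) where

  N : ℕ
  N = suc k

  %-absorbˡ : ∀ a b → (a % N + b) % N ≡ (a + b) % N
  %-absorbˡ a b = begin
    (a % N + b) % N             ≡⟨ %-distribˡ-+ (a % N) b N ⟩
    (a % N % N + b % N) % N     ≡⟨ cong (λ z → (z + b % N) % N) (m%n%n≡m%n a N) ⟩
    (a % N + b % N) % N         ≡⟨ %-distribˡ-+ a b N ⟨
    (a + b) % N                 ∎

  %-absorbʳ : ∀ a b → (a + b % N) % N ≡ (a + b) % N
  %-absorbʳ a b = begin
    (a + b % N) % N             ≡⟨ %-distribˡ-+ a (b % N) N ⟩
    (a % N + b % N % N) % N     ≡⟨ cong (λ z → (a % N + z) % N) (m%n%n≡m%n b N) ⟩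
    (a % N + b % N) % N         ≡⟨ %-distribˡ-+ a b N ⟨
    (a + b) % N                 ∎

  untranslate : ℕ → ℕ → ℕ
  untranslate c x = (x + (N ∸ c % N)) % N

  untranslate<N : ∀ c x → untranslate c x < N
  untranslate<N c x = m%n<n (x + (N ∸ c % N)) N

  untranslate-translate : ∀ c a → a < N → untranslate c ((c + a) % N) ≡ a
  untranslate-translate c a a<N = begin
    ((c + a) % N + t) % N   ≡⟨ %-absorbˡ (c + a) t ⟩
    (c + a + t) % N         ≡⟨ cong (λ z → (z + a + t) % N) (m≡m%n+[m/n]*n c N) ⟩
    (r + q ℕ.* N + a + t) % N ≡⟨ cong (_% N) (regroup r (q ℕ.* N) a t) ⟩
    (a + (r + t + q ℕ.* N)) % N ≡⟨ cong (λ z → (a + (z + q ℕ.* N)) % N) (ℕₚ.m+[n∸m]≡n (m%n≤n c N)) ⟩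
    (a + suc q ℕ.* N) % N     ≡⟨ [m+kn]%n≡m%n a (suc q) N ⟩
    a % N                   ≡⟨ m<n⇒m%n≡m a<N ⟩
    a                       ∎
    where
    open +-*-Solver
    t = N ∸ c % N
    r = c % N
    q = c / N
    regroup : ∀ r p a t → r + p + a + t ≡ a + (r + t + p)
    regroup = solve 4 (λ r p a t → ((r :+ p) :+ a) :+ t := a :+ ((r :+ t) :+ p)) refl

  translate-untranslate : ∀ c x → c < N → x < N → (c + untranslate c x) % N ≡ x
  translate-untranslate c x c<N x<N = begin
    (c + (x + (N ∸ c % N)) % N) % N ≡⟨ %-absorbʳ c (x + (N ∸ c % N)) ⟩
    (c + (x + (N ∸ c % N))) % N     ≡⟨ cong (λ z → (c + (x + (N ∸ z))) % N) (m<n⇒m%n≡m c<N) ⟩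
    (c + (x + (N ∸ c))) % N         ≡⟨ cong (_% N) (swap c x (N ∸ c)) ⟩
    (x + (c + (N ∸ c))) % N         ≡⟨ cong (λ z → (x + z) % N) (ℕₚ.m+[n∸m]≡n (ℕₚ.<⇒≤ c<N)) ⟩
    (x + N) % N                     ≡⟨ [m+n]%n≡m%n x N ⟩
    x % N                           ≡⟨ m<n⇒m%n≡m x<N ⟩
    x                               ∎
    where
    open +-*-Solver
    swap : ∀ c x t → c + (x + t) ≡ x + (c + t)
    swap = solve 3 (λ c x t → c :+ (x :+ t) := x :+ (c :+ t)) refl

  translate-cancel : ∀ c {a b} → a < N → b < N → (c + a) % N ≡ (c + b) % N → a ≡ b
  translate-cancel c {a} {b} a<N b<N e = begin
    a                              ≡⟨ untranslate-translate c a a<N ⟨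
    untranslate c ((c + a) % N)    ≡⟨ cong (untranslate c) e ⟩
    untranslate c ((c + b) % N)    ≡⟨ untranslate-translate c b b<N ⟩
    b                              ∎

  translate-suc : ∀ c a → ((c + a) % N + 1) % N ≡ (c + suc a) % N
  translate-suc c a = trans (%-absorbˡ (c + a) 1)
    (cong (_% N) (trans (ℕₚ.+-assoc c a 1) (cong (_+_ c) (ℕₚ.+-comm a 1))))

  translate-0 : ∀ c → c < N → (c + 0) % N ≡ c
  translate-0 c c<N = trans (cong (_% N) (ℕₚ.+-identityʳ c)) (m<n⇒m%n≡m c<N)

  translate-N : ∀ c → c < N → (c + N) % N ≡ c
  translate-N c c<N = trans ([m+n]%n≡m%n c N) (m<n⇒m%n≡m c<N)

-- The cycle C_N minus one vertex is a path on k = N - 1 vertices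
-- (throughout N = m + 3 ≥ 3, so that C_N is a simple graph of degree 2).

module CycleMinusVertex (m : ℕ) where

  k : ℕ
  k = suc (suc m)

  open Modular k public

  -- the j-th vertex (0-based) of the path C_N ∖ {vᵢ}, i.e. vertex i + j + 1 mod N;
  -- this is exactly the indexing used in the definition of Ŝᵢ
  skip : Fin N → Fin k → Fin N
  skip i j = fromℕ< (m%n<n (toℕ i + suc (toℕ j)) N)

  toℕ-skip : ∀ i j → toℕ (skip i j) ≡ (toℕ i + suc (toℕ j)) % N
  toℕ-skip i j = Finₚ.toℕ-fromℕ< _

  -- its inverse: the position on the path of a vertex v ≠ i
  position : Fin N → Fin N → Fin k
  position i v = (untranslate (toℕ i) (toℕ v) ∸ 1) mod k

  suc-j<N : ∀ (j : Fin k) → suc (toℕ j) < N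
  suc-j<N j = s≤s (Finₚ.toℕ<n j)

  0<N : 0 < N
  0<N = s≤s z≤n

  1<N : 1 < N
  1<N = s≤s (s≤s z≤n)

  skip≢i : ∀ i j → skip i j ≢ i
  skip≢i i j e with translate-cancel (toℕ i) (suc-j<N j) 0<N
    (trans (trans (sym (toℕ-skip i j)) (cong toℕ e)) (sym (translate-0 (toℕ i) (Finₚ.toℕ<n i))))
  ... | ()

  position-skip : ∀ i j → position i (skip i j) ≡ j
  position-skip i j = Finₚ.toℕ-injective (begin
    toℕ (position i (skip i j))                  ≡⟨ Finₚ.toℕ-fromℕ< _ ⟩
    (untranslate I (toℕ (skip i j)) ∸ 1) % k      ≡⟨ cong (λ z → (untranslate I z ∸ 1) % k) (toℕ-skip i j) ⟩
    (untranslate I ((I + suc (toℕ j)) % N) ∸ 1) % k ≡⟨ cong (λ z → (z ∸ 1) % k) (untranslate-translate I (suc (toℕ j)) (suc-j<N j)) ⟩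
    toℕ j % k                                      ≡⟨ m<n⇒m%n≡m (Finₚ.toℕ<n j) ⟩
    toℕ j                                          ∎)
    where I = toℕ i

  skip-position : ∀ i v → v ≢ i → skip i (position i v) ≡ v
  skip-position i v v≢i = Finₚ.toℕ-injective (trans (toℕ-skip i (position i v))
      (trans (cong (λ z → (I + suc z) % N) (Finₚ.toℕ-fromℕ< _)) (by-offset (untranslate I V) refl)))
    where
    I = toℕ i
    V = toℕ v
    -- the offset of v from i is nonzero, so subtracting 1 and adding it back is harmless
    by-offset : ∀ o → untranslate I V ≡ o → (I + suc ((untranslate I V ∸ 1) % k)) % N ≡ V
    by-offset zero eq = contradiction (Finₚ.toℕ-injective (begin
      V                            ≡⟨ translate-untranslate I V (Finₚ.toℕ<n i) (Finₚ.toℕ<n v) ⟨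
      (I + untranslate I V) % N    ≡⟨ cong (λ z → (I + z) % N) eq ⟩
      (I + 0) % N                  ≡⟨ translate-0 I (Finₚ.toℕ<n i) ⟩
      I                            ∎)) v≢i
    by-offset (suc o) eq = begin
      (I + suc ((untranslate I V ∸ 1) % k)) % N ≡⟨ cong (λ z → (I + suc ((z ∸ 1) % k)) % N) eq ⟩
      (I + suc (o % k)) % N                     ≡⟨ cong (λ z → (I + suc z) % N) (m<n⇒m%n≡m o<k) ⟩
      (I + suc o) % N                           ≡⟨ cong (λ z → (I + z) % N) eq ⟨
      (I + untranslate I V) % N                 ≡⟨ translate-untranslate I V (Finₚ.toℕ<n i) (Finₚ.toℕ<n v) ⟩
      V                                         ∎
      where
      o<k : o < k
      o<k = ℕₚ.≤-pred (subst (_< N) eq (untranslate<N I V))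

  cycle-succ⇒path-succ : ∀ i j j' → toℕ (skip i j') ≡ (toℕ (skip i j) + 1) % N → suc (toℕ j) ≡ toℕ j'
  cycle-succ⇒path-succ i j j' e = by-cases (ℕₚ.m≤n⇒m<n∨m≡n (suc-j<N j))
    where
    I = toℕ i
    e' : (I + suc (toℕ j')) % N ≡ (I + suc (suc (toℕ j))) % N
    e' = trans (sym (toℕ-skip i j')) (trans e (trans (cong (λ z → (z + 1) % N) (toℕ-skip i j))
                                                    (translate-suc I (suc (toℕ j)))))
    by-cases : suc (suc (toℕ j)) < N ⊎ suc (suc (toℕ j)) ≡ N → suc (toℕ j) ≡ toℕ j'
    by-cases (inj₁ lt) = sym (ℕₚ.suc-injective (translate-cancel I (suc-j<N j') lt e'))
    by-cases (inj₂ eq) with translate-cancel I (suc-j<N j') 0<N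
      (trans e' (trans (cong (λ z → (I + z) % N) eq)
        (trans (translate-N I (Finₚ.toℕ<n i)) (sym (translate-0 I (Finₚ.toℕ<n i))))))
    ... | ()

  path-succ⇒cycle-succ : ∀ i j j' → suc (toℕ j) ≡ toℕ j' → toℕ (skip i j') ≡ (toℕ (skip i j) + 1) % N
  path-succ⇒cycle-succ i j j' e = begin
    toℕ (skip i j')                   ≡⟨ toℕ-skip i j' ⟩
    (toℕ i + suc (toℕ j')) % N        ≡⟨ cong (λ z → (toℕ i + suc z) % N) e ⟨
    (toℕ i + suc (suc (toℕ j))) % N   ≡⟨ translate-suc (toℕ i) (suc (toℕ j)) ⟨
    ((toℕ i + suc (toℕ j)) % N + 1) % N ≡⟨ cong (λ z → (z + 1) % N) (toℕ-skip i j) ⟨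
    (toℕ (skip i j) + 1) % N          ∎

  cycle-adj⇔path-adj : ∀ i j j' → CycAdj (skip i j) (skip i j') ⇔ PathAdj j j'
  cycle-adj⇔path-adj i j j' = mk⇔
    (λ { (inj₁ e) → inj₁ (cycle-succ⇒path-succ i j j' e) ; (inj₂ e) → inj₂ (cycle-succ⇒path-succ i j' j e) })
    (λ { (inj₁ e) → inj₁ (path-succ⇒cycle-succ i j j' e) ; (inj₂ e) → inj₂ (path-succ⇒cycle-succ i j' j e) })

  Endpoint : Fin k → Set
  Endpoint j = toℕ j ≡ 0 ⊎ suc (toℕ j) ≡ k

  endpoint? : ∀ (j : Fin k) → Dec (Endpoint j)
  endpoint? j = (toℕ j ℕ.≟ 0) ⊎-dec (suc (toℕ j) ℕ.≟ k)

  adj-deleted⇔endpoint : ∀ i j → CycAdj (skip i j) i ⇔ Endpoint j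
  adj-deleted⇔endpoint i j = mk⇔ to from
    where
    I = toℕ i
    to : CycAdj (skip i j) i → Endpoint j
    to (inj₁ e) = by-cases (ℕₚ.m≤n⇒m<n∨m≡n (suc-j<N j))
      where
      e' : (I + 0) % N ≡ (I + suc (suc (toℕ j))) % N
      e' = trans (translate-0 I (Finₚ.toℕ<n i))
             (trans e (trans (cong (λ z → (z + 1) % N) (toℕ-skip i j)) (translate-suc I (suc (toℕ j)))))
      by-cases : suc (suc (toℕ j)) < N ⊎ suc (suc (toℕ j)) ≡ N → Endpoint j
      by-cases (inj₁ lt) with translate-cancel I 0<N lt e'
      ... | ()
      by-cases (inj₂ eq) = inj₂ (ℕₚ.suc-injective eq)
    to (inj₂ e) = inj₁ (ℕₚ.suc-injective (translate-cancel I (suc-j<N j) 1<N (trans (sym (toℕ-skip i j)) e)))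
    from : Endpoint j → CycAdj (skip i j) i
    from (inj₁ e) = inj₂ (trans (toℕ-skip i j) (cong (λ z → (I + suc z) % N) e))
    from (inj₂ e) = inj₁ (sym (begin
      (toℕ (skip i j) + 1) % N          ≡⟨ cong (λ z → (z + 1) % N) (toℕ-skip i j) ⟩
      ((I + suc (toℕ j)) % N + 1) % N   ≡⟨ translate-suc I (suc (toℕ j)) ⟩
      (I + suc (suc (toℕ j))) % N       ≡⟨ cong (λ z → (I + suc z) % N) e ⟩
      (I + N) % N                       ≡⟨ translate-N I (Finₚ.toℕ<n i) ⟩
      I                                 ∎))

  cycle-irreflexive : ∀ (i : Fin N) → ¬ CycAdj i i
  cycle-irreflexive i e = 1≢0 (translate-cancel (toℕ i) 0<N 1<N
      (trans (translate-0 (toℕ i) (Finₚ.toℕ<n i)) (either e)))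
    where
    either : CycAdj i i → toℕ i ≡ (toℕ i + 1) % N
    either (inj₁ e) = e
    either (inj₂ e) = e
    1≢0 : 0 ≢ 1
    1≢0 ()

  private
    two-members : ∀ {l : List A} {a b} → a ∈ₗ l → b ∈ₗ l → a ≢ b → 2 ≤ length l
    two-members (here refl) (here refl) a≢b = contradiction refl a≢b
    two-members {l = _ ∷ _ ∷ _} (here _)  (there _) _ = s≤s (s≤s z≤n)
    two-members {l = _ ∷ _ ∷ _} (there _) _         _ = s≤s (s≤s z≤n)

    -- distinct elements of Fin n have distinct values, so at most one has value t
    one-value : ∀ {n} {l : List (Fin n)} {t} → Unique l → (∀ {x} → x ∈ₗ l → toℕ x ≡ t) → length l ≤ 1
    one-value {l = []}         _ _ = z≤n
    one-value {l = _ ∷ []}     _ _ = s≤s z≤n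
    one-value {l = _ ∷ _ ∷ _} ((x≢y ∷ _) ∷ _) all-t =
      contradiction (Finₚ.toℕ-injective (trans (all-t (here refl)) (sym (all-t (there (here refl)))))) x≢y

    neighbour : ∀ {n} (G : Graph n) {v w} → Adj G v w → w ∈ₗ filter (adj? G v) (allFin n)
    neighbour G {v} {w} a = ∈-filter⁺ (adj? G v) (∈-allFin w) a

  cycle-degree : ∀ (v : Fin N) → 2 ≤ degree (Cycle N) v
  cycle-degree v = two-members (neighbour (Cycle N) next) (neighbour (Cycle N) prev) next≢prev
    where
    V = toℕ v
    w₁ w₂ : Fin N
    w₁ = fromℕ< (m%n<n (V + 1) N)
    w₂ = fromℕ< (m%n<n (V + k) N)
    next : CycAdj v w₁
    next = inj₁ (Finₚ.toℕ-fromℕ< _)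
    prev : CycAdj v w₂
    prev = inj₂ (sym (begin
      (toℕ w₂ + 1) % N          ≡⟨ cong (λ z → (z + 1) % N) (Finₚ.toℕ-fromℕ< (m%n<n (V + k) N)) ⟩
      ((V + k) % N + 1) % N     ≡⟨ translate-suc V k ⟩
      (V + N) % N               ≡⟨ translate-N V (Finₚ.toℕ<n v) ⟩
      V                         ∎))
    next≢prev : w₁ ≢ w₂
    next≢prev e with translate-cancel V 1<N (ℕₚ.n<1+n k)
      (trans (sym (Finₚ.toℕ-fromℕ< (m%n<n (V + 1) N)))
        (trans (cong toℕ e) (Finₚ.toℕ-fromℕ< (m%n<n (V + k) N))))
    ... | ()

  interior-degree : ∀ (j : Fin k) → ¬ Endpoint j → 2 ≤ degree (Path k) j
  interior-degree j not-end = by-value (toℕ j) refl (ℕₚ.n≢0⇒n>0 (not-end ∘ inj₁))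
    where
    sj<k : suc (toℕ j) < k
    sj<k = ℕₚ.≤∧≢⇒< (Finₚ.toℕ<n j) (not-end ∘ inj₂)
    by-value : ∀ J → toℕ j ≡ J → 0 < J → 2 ≤ degree (Path k) j
    by-value (suc p) eq _ =
      two-members (neighbour (Path k) right) (neighbour (Path k) left) right≢left
      where
      p<k : p < k
      p<k = ℕₚ.<-trans (ℕₚ.n<1+n p) (subst (_< k) eq (Finₚ.toℕ<n j))
      w₁ w₂ : Fin k
      w₁ = fromℕ< sj<k
      w₂ = fromℕ< p<k
      right : PathAdj j w₁
      right = inj₁ (sym (Finₚ.toℕ-fromℕ< sj<k))
      left : PathAdj j w₂
      left = inj₂ (trans (cong suc (Finₚ.toℕ-fromℕ< p<k)) (sym eq))
      right≢left : w₁ ≢ w₂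
      right≢left e = ℕₚ.<-irrefl (sym p+2≡p) (ℕₚ.<-trans (ℕₚ.n<1+n p) (ℕₚ.n<1+n (suc p)))
        where
        p+2≡p : suc (suc p) ≡ p
        p+2≡p = trans (cong suc (sym eq))
          (trans (sym (Finₚ.toℕ-fromℕ< sj<k)) (trans (cong toℕ e) (Finₚ.toℕ-fromℕ< p<k)))

  endpoint-degree : ∀ (j : Fin k) → Endpoint j → degree (Path k) j ≤ 1
  endpoint-degree j end = one-value (Uniqueₚ.filter⁺ (adj? (Path k) j) (Uniqueₚ.allFin⁺ k))
      (λ w∈ → only-neighbour end (proj₂ (∈-filter⁻ (adj? (Path k) j) {xs = allFin k} w∈)))
    where
    the-neighbour : Endpoint j → ℕ
    the-neighbour (inj₁ _) = 1
    the-neighbour (inj₂ _) = ℕ.pred (toℕ j)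

    only-neighbour : (end : Endpoint j) → ∀ {w} → PathAdj j w → toℕ w ≡ the-neighbour end
    only-neighbour (inj₁ j≡0)   (inj₁ e) = trans (sym e) (cong suc j≡0)
    only-neighbour (inj₁ j≡0)   (inj₂ e) with trans e j≡0
    ... | ()
    only-neighbour (inj₂ j+1≡k) {w} (inj₁ e) =
      contradiction (subst (_< k) (trans (sym e) j+1≡k) (Finₚ.toℕ<n w)) (ℕₚ.<-irrefl refl)
    only-neighbour (inj₂ _)     (inj₂ e) = cong ℕ.pred e

  private
    two≰one : ¬ (2 ≤ 1)
    two≰one (s≤s ())

  module ReadAlongPath (σ : Vec (Fin N) N) (τ : Vec (Fin k) k) (i : Fin N)
    (σ-max : toℕ (lookup σ i) ≡ k) (σ≈τ : ∀ j → toℕ (lookup σ (skip i j)) ≡ toℕ (lookup τ j)) where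

    σ≈τ-at : ∀ w → w ≢ i → toℕ (lookup σ w) ≡ toℕ (lookup τ (position i w))
    σ≈τ-at w w≢i = trans (cong (toℕ ∘ lookup σ) (sym (skip-position i w w≢i))) (σ≈τ (position i w))

    max-is-peak : IsPeak (Cycle N) σ i
    max-is-peak = cycle-degree i , below
      where
      below : ∀ w → CycAdj i w → lookup σ w Fin.< lookup σ i
      below w a with w Finₚ.≟ i
      ... | yes refl = contradiction a (cycle-irreflexive i)
      ... | no w≢i   = subst₂ _<_ (sym (σ≈τ-at w w≢i)) (sym σ-max) (Finₚ.toℕ<n (lookup τ (position i w)))

    -- an endpoint is adjacent to vᵢ, hence no peak of σ, and has degree ≤ 1 in the path
    endpoint-no-peak : ∀ j → Endpoint j → IsPeak (Cycle N) σ (skip i j) ⇔ IsPeak (Path k) τ j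
    endpoint-no-peak j end = mk⇔
      (λ pk → contradiction (proj₂ pk i (Equivalence.from (adj-deleted⇔endpoint i j) end)) max-not-below)
      (λ pk → contradiction (ℕₚ.≤-trans (proj₁ pk) (endpoint-degree j end)) two≰one)
      where
      max-not-below : ¬ (lookup σ i Fin.< lookup σ (skip i j))
      max-not-below lt = ℕₚ.<-asym (subst₂ _<_ σ-max (σ≈τ j) lt) (Finₚ.toℕ<n (lookup τ j))

    -- an interior vertex has degree 2 in both graphs and the same neighbours,
    -- since its cycle neighbours are never vᵢ
    interior-peak : ∀ j → ¬ Endpoint j → IsPeak (Cycle N) σ (skip i j) ⇔ IsPeak (Path k) τ j
    interior-peak j not-end = mk⇔ to from
      where
      to : IsPeak (Cycle N) σ (skip i j) → IsPeak (Path k) τ j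
      to pk = interior-degree j not-end ,
        λ j' a → subst₂ _<_ (σ≈τ j') (σ≈τ j)
                   (proj₂ pk (skip i j') (Equivalence.from (cycle-adj⇔path-adj i j j') a))
      from : IsPeak (Path k) τ j → IsPeak (Cycle N) σ (skip i j)
      from pk = cycle-degree (skip i j) , below
        where
        below : ∀ w → CycAdj (skip i j) w → lookup σ w Fin.< lookup σ (skip i j)
        below w a with w Finₚ.≟ i
        ... | yes refl = contradiction (Equivalence.to (adj-deleted⇔endpoint i j) a) not-end
        ... | no w≢i   = subst₂ _<_ (sym (σ≈τ-at w w≢i)) (sym (σ≈τ j))
          (proj₂ pk (position i w) (Equivalence.to (cycle-adj⇔path-adj i j (position i w))
            (subst (CycAdj (skip i j)) (sym (skip-position i w w≢i)) a)))

    path-peak : ∀ j → IsPeak (Cycle N) σ (skip i j) ⇔ IsPeak (Path k) τ j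
    path-peak j with endpoint? j
    ... | yes end    = endpoint-no-peak j end
    ... | no not-end = interior-peak j not-end

  skip∈S⇔∈Ŝ : ∀ (S : Subset N) i j → (skip i j ∈ S) ⇔ (suc (toℕ j) ∈ₗ hatS S i)
  skip∈S⇔∈Ŝ S i j = mk⇔ to from
    where
    in-S? = λ (j : Fin k) → skip i j ∈? S
    to : skip i j ∈ S → suc (toℕ j) ∈ₗ hatS S i
    to j∈ = ∈-map⁺ (suc ∘ toℕ) (∈-filter⁺ in-S? (∈-allFin j) j∈)
    from : suc (toℕ j) ∈ₗ hatS S i → skip i j ∈ S
    from p∈ with ∈-map⁻ (suc ∘ toℕ) p∈
    ... | j' , j'∈ , e = subst (λ z → skip i z ∈ S) (sym (Finₚ.toℕ-injective (ℕₚ.suc-injective e)))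
                           (proj₂ (∈-filter⁻ in-S? {xs = allFin k} j'∈))

  top : Fin N
  top = fromℕ k

  toℕ-top : toℕ top ≡ k
  toℕ-top = Finₚ.toℕ-fromℕ k

  lower : Fin N → Fin k
  lower x = toℕ x mod k

  toℕ-lower : ∀ x → toℕ x < k → toℕ (lower x) ≡ toℕ x
  toℕ-lower x x<k = trans (Finₚ.toℕ-fromℕ< _) (m<n⇒m%n≡m x<k)

  top-attained : ∀ (σ : Vec (Fin N) N) → Injective σ → Σ (Fin N) λ i → lookup σ i ≡ top
  top-attained σ inj with Finₚ.any? (λ i → lookup σ i Finₚ.≟ top)
  ... | yes found = found
  ... | no absent with Finₚ.pigeonhole (ℕₚ.n<1+n k) (lower ∘ lookup σ)
  ... | a , b , a<b , e = contradiction (inj a b (Finₚ.toℕ-injective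
          (trans (sym (toℕ-lower _ (below a))) (trans (cong toℕ e) (toℕ-lower _ (below b))))))
          (Finₚ.<⇒≢ a<b)
    where
    below : ∀ v → toℕ (lookup σ v) < k
    below v = ℕₚ.≤∧≢⇒< (ℕₚ.≤-pred (Finₚ.toℕ<n (lookup σ v)))
                (λ e → absent (v , Finₚ.toℕ-injective (trans e (sym toℕ-top))))

  module Fiber (S : Subset N) (i : Fin N) where

    InFiber : Vec (Fin N) N → Set
    InFiber σ = (Injective σ × PeaksCycleExactly S σ) × (lookup σ i ≡ top)

    inFiber? : ∀ σ → Dec (InFiber σ)
    inFiber? σ = (injective? σ ×-dec peaksCycleExactly? S σ) ×-dec (lookup σ i Finₚ.≟ top)

    InPath : Vec (Fin k) k → Set
    InPath τ = Injective τ × PeaksPathExactly (hatS S i) τ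

    inPath? : ∀ τ → Dec (InPath τ)
    inPath? τ = injective? τ ×-dec peaksPathExactly? (hatS S i) τ

    restrict : Vec (Fin N) N → Vec (Fin k) k
    restrict σ = tabulate (λ j → lower (lookup σ (skip i j)))

    extendAt : ∀ {v : Fin N} → Dec (v ≡ i) → Fin k → Fin N
    extendAt (yes _) _ = top
    extendAt (no _)  x = inject₁ x

    extended : Vec (Fin k) k → Fin N → Fin N
    extended τ v = extendAt (v Finₚ.≟ i) (lookup τ (position i v))

    extend : Vec (Fin k) k → Vec (Fin N) N
    extend τ = tabulate (extended τ)

    extended-i : ∀ τ → extended τ i ≡ top
    extended-i τ with i Finₚ.≟ i
    ... | yes _   = refl
    ... | no i≢i  = contradiction refl i≢i

    extended-≢ : ∀ τ v → v ≢ i → extended τ v ≡ inject₁ (lookup τ (position i v))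
    extended-≢ τ v v≢i with v Finₚ.≟ i
    ... | yes v≡i = contradiction v≡i v≢i
    ... | no _    = refl

    module Restrict (σ : Vec (Fin N) N) (inj : Injective σ) (σ-top : lookup σ i ≡ top) where

      σ-max : toℕ (lookup σ i) ≡ k
      σ-max = trans (cong toℕ σ-top) toℕ-top

      below-top : ∀ w → w ≢ i → toℕ (lookup σ w) < k
      below-top w w≢i = ℕₚ.≤∧≢⇒< (ℕₚ.≤-pred (Finₚ.toℕ<n (lookup σ w)))
        (λ e → w≢i (inj w i (Finₚ.toℕ-injective (trans e (sym σ-max)))))

      lookup-restrict : ∀ j → lookup (restrict σ) j ≡ lower (lookup σ (skip i j))
      lookup-restrict = Vecₚ.lookup∘tabulate (λ j → lower (lookup σ (skip i j)))

      σ≈τ : ∀ j → toℕ (lookup σ (skip i j)) ≡ toℕ (lookup (restrict σ) j)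
      σ≈τ j = sym (trans (cong toℕ (lookup-restrict j)) (toℕ-lower _ (below-top (skip i j) (skip≢i i j))))

      restrict-injective : Injective (restrict σ)
      restrict-injective j j' e = begin
        j                        ≡⟨ position-skip i j ⟨
        position i (skip i j)    ≡⟨ cong (position i) (inj (skip i j) (skip i j') (Finₚ.toℕ-injective
                                      (trans (σ≈τ j) (trans (cong toℕ e) (sym (σ≈τ j')))))) ⟩
        position i (skip i j')   ≡⟨ position-skip i j' ⟩
        j'                       ∎

      open ReadAlongPath σ (restrict σ) i σ-max σ≈τ public

      extend-restrict : extend (restrict σ) ≡ σ
      extend-restrict = vec-ext _ _ same
        where
        same : ∀ v → lookup (extend (restrict σ)) v ≡ lookup σ v
        same v with v Finₚ.≟ i
        ... | yes refl = trans (Vecₚ.lookup∘tabulate (extended (restrict σ)) v)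
                               (trans (extended-i (restrict σ)) (sym σ-top))
        ... | no v≢i  = trans (Vecₚ.lookup∘tabulate (extended (restrict σ)) v)
          (trans (extended-≢ (restrict σ) v v≢i) (Finₚ.toℕ-injective (begin
            toℕ (inject₁ (lookup (restrict σ) (position i v))) ≡⟨ Finₚ.toℕ-inject₁ _ ⟩
            toℕ (lookup (restrict σ) (position i v))           ≡⟨ σ≈τ (position i v) ⟨
            toℕ (lookup σ (skip i (position i v)))             ≡⟨ cong (toℕ ∘ lookup σ) (skip-position i v v≢i) ⟩
            toℕ (lookup σ v)                                   ∎)))

    module Extend (τ : Vec (Fin k) k) (inj : Injective τ) where

      lookup-extend : ∀ v → lookup (extend τ) v ≡ extended τ v
      lookup-extend = Vecₚ.lookup∘tabulate (extended τ)

      extend-top : lookup (extend τ) i ≡ top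
      extend-top = trans (lookup-extend i) (extended-i τ)

      σ-max : toℕ (lookup (extend τ) i) ≡ k
      σ-max = trans (cong toℕ extend-top) toℕ-top

      σ≈τ : ∀ j → toℕ (lookup (extend τ) (skip i j)) ≡ toℕ (lookup τ j)
      σ≈τ j = begin
        toℕ (lookup (extend τ) (skip i j))              ≡⟨ cong toℕ (lookup-extend (skip i j)) ⟩
        toℕ (extended τ (skip i j))                     ≡⟨ cong toℕ (extended-≢ τ (skip i j) (skip≢i i j)) ⟩
        toℕ (inject₁ (lookup τ (position i (skip i j)))) ≡⟨ Finₚ.toℕ-inject₁ _ ⟩
        toℕ (lookup τ (position i (skip i j)))          ≡⟨ cong (toℕ ∘ lookup τ) (position-skip i j) ⟩
        toℕ (lookup τ j)                                ∎

      open ReadAlongPath (extend τ) τ i σ-max σ≈τ public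

      extend-≢ : ∀ v → v ≢ i → lookup (extend τ) v ≡ inject₁ (lookup τ (position i v))
      extend-≢ v v≢i = trans (lookup-extend v) (extended-≢ τ v v≢i)

      top≢inject₁ : ∀ (x : Fin k) → top ≢ inject₁ x
      top≢inject₁ x e = ℕₚ.<-irrefl (trans (sym (Finₚ.toℕ-inject₁ x)) (trans (cong toℕ (sym e)) toℕ-top))
                                    (Finₚ.toℕ<n x)

      extend-injective : Injective (extend τ)
      extend-injective v v' e with v Finₚ.≟ i | v' Finₚ.≟ i
      ... | yes v≡i | yes v'≡i = trans v≡i (sym v'≡i)
      ... | yes refl | no v'≢i = contradiction (trans (sym extend-top) (trans e (extend-≢ v' v'≢i))) (top≢inject₁ _)
      ... | no v≢i | yes refl  = contradiction (trans (sym extend-top) (trans (sym e) (extend-≢ v v≢i))) (top≢inject₁ _)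
      ... | no v≢i | no v'≢i   = begin
        v                         ≡⟨ skip-position i v v≢i ⟨
        skip i (position i v)     ≡⟨ cong (skip i) (inj _ _ (Finₚ.inject₁-injective
                                        (trans (sym (extend-≢ v v≢i)) (trans e (extend-≢ v' v'≢i))))) ⟩
        skip i (position i v')    ≡⟨ skip-position i v' v'≢i ⟩
        v'                        ∎

      restrict-extend : restrict (extend τ) ≡ τ
      restrict-extend = vec-ext _ _ λ j →
        trans (Vecₚ.lookup∘tabulate (λ j → lower (lookup (extend τ) (skip i j))) j)
          (Finₚ.toℕ-injective (trans (toℕ-lower _ (subst (_< k) (sym (σ≈τ j)) (Finₚ.toℕ<n (lookup τ j))))
                                     (σ≈τ j)))

    restrict-InPath : ∀ σ → InFiber σ → InPath (restrict σ)
    restrict-InPath σ ((inj , peaks) , σ-top) = restrict-injective ,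
        λ j → ⇔.trans (⇔.sym (path-peak j)) (⇔.trans (peaks (skip i j)) (skip∈S⇔∈Ŝ S i j))
      where open Restrict σ inj σ-top

    extend-InFiber : i ∈ S → ∀ τ → InPath τ → InFiber (extend τ)
    extend-InFiber i∈S τ (inj , peaks) = (extend-injective , peaks-extend) , extend-top
      where
      open Extend τ inj
      peaks-extend : PeaksCycleExactly S (extend τ)
      peaks-extend v with v Finₚ.≟ i
      ... | yes refl = mk⇔ (λ _ → i∈S) (λ _ → max-is-peak)
      ... | no v≢i   = subst (λ w → IsPeak (Cycle N) (extend τ) w ⇔ (w ∈ S)) (skip-position i v v≢i)
        (⇔.trans (path-peak j) (⇔.trans (peaks j) (⇔.sym (skip∈S⇔∈Ŝ S i j))))
        where j = position i v

    fiber-count : i ∈ S → count inFiber? (allVecs N N) ≡ count inPath? (allVecs k k)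
    fiber-count i∈S = count-bijection inFiber? inPath? (allVecs N N) (allVecs k k)
      (allVecs-unique N N) (allVecs-unique k k) (λ {σ} _ → allVecs-complete σ) (λ {τ} _ → allVecs-complete τ)
      restrict extend
      (λ {σ} → restrict-InPath σ) (λ {τ} → extend-InFiber i∈S τ)
      (λ {σ} ((inj , _) , σ-top) → Restrict.extend-restrict σ inj σ-top)
      (λ {τ} (inj , _) → Extend.restrict-extend τ inj)

    -- the maximum is a peak, so it can only sit in S
    fiber-empty : ¬ (i ∈ S) → count inFiber? (allVecs N N) ≡ 0
    fiber-empty i∉S = cong length (filter-none inFiber? {xs = allVecs N N}
      (All.universal (λ σ ((inj , peaks) , σ-top) → i∉S (Equivalence.to (peaks i) (Restrict.max-is-peak σ inj σ-top)))
                     (allVecs N N)))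

  module _ (S : Subset N) (i : Fin N) where

    private
      in-S? : Decidable (λ (j : Fin k) → skip i j ∈ S)
      in-S? j = skip i j ∈? S

    Ŝ-finite-set : IsFinSetOfPos (hatS S i)
    Ŝ-finite-set =
      AllPairsₚ.map⁺ (AllPairsₚ.filter⁺ in-S? (AllPairsₚ.tabulate⁺-< (λ j<j' → s≤s j<j'))) ,
      Allₚ.map⁺ (All.universal (λ _ → s≤s z≤n) (filter in-S? (allFin k)))

    Ŝ-bounded : All (_≤ k) (hatS S i)
    Ŝ-bounded = Allₚ.map⁺ (All.universal Finₚ.toℕ<n (filter in-S? (allFin k)))

    -- S ∖ {vᵢ} read along the path is Ŝᵢ
    ∣S∣≡1+∣Ŝ∣ : i ∈ S → ∣ S ∣ ≡ suc (length (hatS S i))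
    ∣S∣≡1+∣Ŝ∣ i∈S = begin
      ∣ S ∣                                                ≡⟨ ∣∣-count S id (_∈? S) (λ _ → ⇔.refl) ⟩
      count (_∈? S) (allFin N)                             ≡⟨ count-remove (_∈? S) Finₚ._≟_ i (allFin N)
                                                               (Uniqueₚ.allFin⁺ N) (∈-allFin i) i∈S ⟩
      suc (count (P-but? (_∈? S) Finₚ._≟_ i) (allFin N))   ≡⟨ cong suc others ⟩
      suc (count in-S? (allFin k))                         ≡⟨ cong suc (length-map (suc ∘ toℕ) (filter in-S? (allFin k))) ⟨
      suc (length (hatS S i))                              ∎
      where
      others : count (P-but? (_∈? S) Finₚ._≟_ i) (allFin N) ≡ count in-S? (allFin k)
      others = count-bijection (P-but? (_∈? S) Finₚ._≟_ i) in-S? (allFin N) (allFin k)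
        (Uniqueₚ.allFin⁺ N) (Uniqueₚ.allFin⁺ k) (λ {v} _ → ∈-allFin v) (λ {j} _ → ∈-allFin j)
        (position i) (skip i)
        (λ {v} (v∈S , v≢i) → subst (_∈ S) (sym (skip-position i v v≢i)) v∈S)
        (λ {j} j∈S → j∈S , skip≢i i j)
        (λ {v} (_ , v≢i) → skip-position i v v≢i) (λ {j} _ → position-skip i j)

  count-by-maximum : ∀ (S : Subset N) →
    countCycle N S ≡ sum (map (λ i → countPath (hatS S i) k) (filter (_∈? S) (allFin N)))
  count-by-maximum S = begin
    countCycle N S                                                 ≡⟨ count-filter (peaksCycleExactly? S) injective? (allVecs N N) ⟩
    count inP? (allVecs N N)                                       ≡⟨ count-partition inP? (λ i σ → lookup σ i Finₚ.≟ top)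
                                                                        (allFin N) (Uniqueₚ.allFin⁺ N) ∈-allFin
                                                                        (λ {σ} p → top-attained σ (proj₁ p))
                                                                        (λ p e e' → proj₁ p _ _ (trans e (sym e')))
                                                                        (allVecs N N) ⟩
    sum (map fiber (allFin N))                                     ≡⟨ sum-map-filter (_∈? S) fiber (allFin N)
                                                                        (λ i → Fiber.fiber-empty S i) ⟩
    sum (map fiber (filter (_∈? S) (allFin N)))                    ≡⟨ sum-map-cong (filter (_∈? S) (allFin N)) fiber≡path ⟩
    sum (map (λ i → countPath (hatS S i) k) (filter (_∈? S) (allFin N))) ∎
    where
    inP? : ∀ σ → Dec (Injective σ × PeaksCycleExactly S σ)
    inP? σ = injective? σ ×-dec peaksCycleExactly? S σ

    fiber : Fin N → ℕ
    fiber i = count (Fiber.inFiber? S i) (allVecs N N)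

    fiber≡path : ∀ {i} → i ∈ₗ filter (_∈? S) (allFin N) → fiber i ≡ countPath (hatS S i) k
    fiber≡path {i} i∈ = trans (Fiber.fiber-count S i (proj₂ (∈-filter⁻ (_∈? S) {xs = allFin N} i∈)))
      (sym (count-filter (peaksPathExactly? (hatS S i)) injective? (allVecs k k)))

+-sum : (f : A → ℕ) (xs : List A) → + sum (map f xs) ≡ sumℤ (map (+_ ∘ f) xs)
+-sum f []       = refl
+-sum f (x ∷ xs) = trans (ℤₚ.pos-+ (f x) (sum (map f xs))) (cong (ℤ._+_ (+ f x)) (+-sum f xs))

sumℤ-map-* : (c : ℤ) (g : A → ℤ) (xs : List A) → sumℤ (map (λ a → c * g a) xs) ≡ c * sumℤ (map g xs)
sumℤ-map-* c g []       = sym (ℤₚ.*-zeroʳ c)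
sumℤ-map-* c g (x ∷ xs) = trans (cong (ℤ._+_ (c * g x)) (sumℤ-map-* c g xs)) (sym (ℤₚ.*-distribˡ-+ c (g x) _))

sumℤ-map-cong : {f g : A → ℤ} (xs : List A) → (∀ {x} → x ∈ₗ xs → f x ≡ g x) → sumℤ (map f xs) ≡ sumℤ (map g xs)
sumℤ-map-cong []       f≡g = refl
sumℤ-map-cong (x ∷ xs) f≡g = cong₂ ℤ._+_ (f≡g (here refl)) (sumℤ-map-cong xs (f≡g ∘ there))

-- Corollary 2.2.  The counting formula holds for every S.

corollary2p2 : (p : List ℕ → ℕ → ℤ) → IsPeakPolynomials p →
    (n : ℕ) → 3 ≤ n → (S : Subset n) → Admissible n S →
    + countCycle n S ≡
      + (2 ^ (n ∸ ∣ S ∣ ∸ 1)) * sumℤ (map (λ i → p (hatS S i) (n ∸ 1)) (filter (_∈? S) (allFin n)))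
corollary2p2 p peak-polynomials (suc (suc (suc m))) (s≤s (s≤s (s≤s z≤n))) S _ = begin
  + countCycle N S                                             ≡⟨ cong +_ (count-by-maximum S) ⟩
  + sum (map (λ i → countPath (hatS S i) k) S-list)            ≡⟨ +-sum _ S-list ⟩
  sumℤ (map (λ i → + countPath (hatS S i) k) S-list)           ≡⟨ sumℤ-map-cong S-list billey-burdzy-sagan ⟩
  sumℤ (map (λ i → 2^ * p (hatS S i) k) S-list)                ≡⟨ sumℤ-map-* 2^ (λ i → p (hatS S i) k) S-list ⟩
  2^ * sumℤ (map (λ i → p (hatS S i) k) S-list)                ∎
  where
  open CycleMinusVertex m
  S-list = filter (_∈? S) (allFin N)
  2^ = + (2 ^ (N ∸ ∣ S ∣ ∸ 1))

  -- |P(Ŝᵢ;k)| = 2^(k-|Ŝᵢ|-1) p_{Ŝᵢ}(k), and k - |Ŝᵢ| = N - |S|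
  billey-burdzy-sagan : ∀ {i} → i ∈ₗ S-list → + countPath (hatS S i) k ≡ 2^ * p (hatS S i) k
  billey-burdzy-sagan {i} i∈ = begin
    + countPath (hatS S i) k                                ≡⟨ proj₂ (peak-polynomials (hatS S i) (Ŝ-finite-set S i))
                                                                  k (s≤s z≤n) (Ŝ-bounded S i) ⟩
    + (2 ^ (N ∸ suc (length (hatS S i)) ∸ 1)) * p (hatS S i) k ≡⟨ cong (λ z → + (2 ^ (N ∸ z ∸ 1)) * p (hatS S i) k)
                                                                  (∣S∣≡1+∣Ŝ∣ S i (proj₂ (∈-filter⁻ (_∈? S) {xs = allFin N} i∈))) ⟨
    2^ * p (hatS S i) k                                     ∎
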